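{- For all groves $x,y,z$ of positive degree one has $$(x\dashv y)\dashv z=x\dashv(y+z),\qquad (x\vdash y)\dashv z=x\vdash(y\dashv z),\qquad (x+y)\vdash z=x\vdash(y\vdash z),$$ and for every grove $x$ of positive degree, $|\vdash x=x=x\dashv |$.
   Context: A planar binary tree of degree $n\ge 0$ is a planar rooted tree (up to planar isotopy) with $n+1$ leaves in which every internal vertex has exactly two inputs; $Y_n$ is the set of these trees, $Y_0=\{|\}$. For $x\in Y_p$, $y\in Y_q$ the grafting $x\vee y\in Y_{p+q+1}$ joins the roots of $x$ and $y$ to a new vertex with a new root; every $x\in Y_n$, $n\ge1$, decomposes uniquely as $x=x^l\vee x^r$. Each $Y_n$ carries the Tamari partial order: the smallest partial order such that $(a\vee b)\vee c\le a\vee(b\vee c)$ for all trees $a,b,c$, and $a\le b$ implies $a\vee c\le b\vee c$ and $c\vee a\le c\vee b$. For $x\in Y_p,y\in Y_q$, $x/y\in Y_{p+q}$ is obtained by identifying the root of $x$ with the leftmost leaf of $y$, and $x\backslash y\in Y_{p+q}$ by identifying the rightmost leaf of $x$ with the root of $y$. The sum of trees is $x+y:=\{z\in Y_{p+q}: x/y\le z\le x\backslash y\}$. A grove is a nonempty subset of some $Y_n$; operations on groves are extended from trees by distributivity (union over all pairs of elements). Grafting a tree with a grove is done elementwise: $a\vee G=\{a\vee g:g\in G\}$, $G\vee b=\{g\vee b: g\in G\}$. Left sum and Right sum of trees: $x\dashv y:=x^l\vee(x^r+y)$ for $x\ne|$, and $x\vdash y:=(x+y^l)\vee y^r$ for $y\ne|$;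 also $|\dashv y=|$ and $x\vdash|=|$ for $x,y\neq |$. -}

module Defs where

open import Data.Nat using (ℕ; zero; suc) renaming (_+_ to _+ℕ_)
open import Data.Product using (Σ; ∃; _×_; _,_)
open import Relation.Binary.PropositionalEquality using (_≡_)
open import Relation.Unary using (Pred)
open import Level using (0ℓ)

infixr 6 _∨_
data Tree : Set where
  ∣  : Tree
  _∨_ : Tree → Tree → Tree

degree : Tree → ℕ
degree ∣ = 0
degree (x ∨ y) = suc (degree x +ℕ degree y)

infix 4 _≤T_
data _≤T_ : Tree → Tree → Set where
  ≤-refl  : ∀ {a} → a ≤T a
  ≤-trans : ∀ {a b c} → a ≤T b → b ≤T c → a ≤T c
  ≤-assoc : ∀ {a b c} → (a ∨ b) ∨ c ≤T a ∨ (b ∨ c)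
  ≤-left  : ∀ {a b c} → a ≤T b → a ∨ c ≤T b ∨ c
  ≤-right : ∀ {a b c} → a ≤T b → c ∨ a ≤T c ∨ b

_/_ : Tree → Tree → Tree
x / ∣ = x
x / (l ∨ r) = (x / l) ∨ r

_\\_ : Tree → Tree → Tree
∣ \\ y = y
(l ∨ r) \\ y = l ∨ (r \\ y)

Grove : Set₁
Grove = Pred Tree 0ℓ

IsGroveOfDegree : ℕ → Grove → Set
IsGroveOfDegree n G = (∃ λ t → G t) × (∀ t → G t → degree t ≡ n)

IsPosGrove : Grove → Set
IsPosGrove G = ∃ λ n → IsGroveOfDegree (suc n) G

⟦_⟧ : Tree → Grove
⟦ t ⟧ s = s ≡ t

_+T_ : Tree → Tree → Grove
(x +T y) z = (x / y ≤T z) × (z ≤T x \\ y)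

_∨G_ : Tree → Grove → Grove
(a ∨G G) z = ∃ λ g → G g × z ≡ a ∨ g

_G∨_ : Grove → Tree → Grove
(G G∨ b) z = ∃ λ g → G g × z ≡ g ∨ b

_⊣T_ : Tree → Tree → Grove
∣ ⊣T y = ⟦ ∣ ⟧
(xl ∨ xr) ⊣T y = xl ∨G (xr +T y)

_⊢T_ : Tree → Tree → Grove
x ⊢T ∣ = ⟦ ∣ ⟧
x ⊢T (yl ∨ yr) = (x +T yl) G∨ yr

lift : (Tree → Tree → Grove) → Grove → Grove → Grove
lift op G H z = ∃ λ x → ∃ λ y → G x × H y × op x y z

infixl 6 _+_ _⊣_ _⊢_
_+_ _⊣_ _⊢_ : Grove → Grove → Grove
_+_ = lift _+T_
_⊣_ = lift _⊣T_
_⊢_ = lift _⊢T_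

-- The sum x + y of two trees is the set of their shuffles: trees whose root is the
-- root of x above a shuffle of its right subtree with y, or the root of y above a
-- shuffle of x with its left subtree. Shuffles lie in the interval [x/y, x\y] by a
-- direct computation. Conversely, right bracket vectors are Tamari-monotone, so a
-- tree z of the interval has rbv z squeezed between rbv x ++ rbv y and the same
-- vector with the right spine of x raised by deg y; the root of z is the first entry
-- equal to the length of its tail, and the squeeze forces it onto the root of x or of
-- y. Shuffling is associative by case analysis on roots, and since ⊣ and ⊢ graft
-- onto a fixed root of x resp. y, the identities reduce to this associativity and to
-- the unit laws for shuffling with |.
module Submission where

open import Defs
open import Data.Empty using (⊥; ⊥-elim)
open import Data.List using (List; []; _∷_; _++_; length)
open import Data.List.Properties
  using (++-assoc; ++-identityʳ; ++-conicalˡ; ++-conicalʳ; ∷-injective; length-++; length-++-≤ˡ; length-++-sucʳ)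
import Data.List.Relation.Binary.Pointwise as Pointwise
open Pointwise using (Pointwise; []; _∷_; Pointwise-length; ++⁺)
open import Data.Nat using (ℕ; suc; _≤_; _<_; s≤s; z≤n) renaming (_+_ to _+ℕ_)
import Data.Nat.Properties as ℕ
open import Data.Product using (_×_; _,_; ∃; map₁; map₂)
open import Data.Sum using (_⊎_; inj₁; inj₂)
open import Relation.Binary.PropositionalEquality
  using (_≡_; refl; sym; trans; cong; cong₂; subst)
open import Relation.Unary using (_∉_; _⊆_; _≐_)

infix 4 _≼_
_≼_ : List ℕ → List ℕ → Set
_≼_ = Pointwise _≤_

≼-refl : ∀ {A} → A ≼ A
≼-refl = Pointwise.refl ℕ.≤-refl

≼-reflexive : ∀ {A B} → A ≡ B → A ≼ B
≼-reflexive refl = ≼-refl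

≼-trans : ∀ {A B C} → A ≼ B → B ≼ C → A ≼ C
≼-trans = Pointwise.transitive ℕ.≤-trans

≼-antisym : ∀ {A B} → A ≼ B → B ≼ A → A ≡ B
≼-antisym p q = Pointwise.Pointwise-≡⇒≡ (Pointwise.antisymmetric ℕ.≤-antisym p q)

≼-++⁺ʳ : ∀ {A B} C → A ≼ B → A ++ C ≼ B ++ C
≼-++⁺ʳ C p = ++⁺ p ≼-refl

≼[]⇒≡[] : ∀ {A} → A ≼ [] → A ≡ []
≼[]⇒≡[] [] = refl

≼-++⁻ : ∀ A {B C D} → length A ≡ length C → A ++ B ≼ C ++ D → A ≼ C × B ≼ D
≼-++⁻ []      {C = []}    _  p       = [] , p
≼-++⁻ (a ∷ A) {C = c ∷ C} eq (h ∷ p) = map₁ (h ∷_) (≼-++⁻ A (ℕ.suc-injective eq) p)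

≼-++-split : ∀ C {D L} → L ≼ C ++ D → ∃ λ L₁ → ∃ λ L₂ → L ≡ L₁ ++ L₂ × L₁ ≼ C × L₂ ≼ D
≼-++-split []      p       = [] , _ , refl , [] , p
≼-++-split (c ∷ C) (h ∷ p) with ≼-++-split C p
... | L₁ , L₂ , refl , p₁ , p₂ = _ ∷ L₁ , L₂ , refl , h ∷ p₁ , p₂

≼-sandwich-++ʳ : ∀ {A A′ R L} → length A ≡ length A′ → A ++ R ≼ L → L ≼ A′ ++ R →
                 ∃ λ P → L ≡ P ++ R × A ≼ P × P ≼ A′
≼-sandwich-++ʳ {A} {A′} {R} eq lo hi with ≼-++-split A′ hi
... | P , Q , refl , P≼A′ , Q≼R with ≼-++⁻ A (trans eq (sym (Pointwise-length P≼A′))) lo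
... | A≼P , R≼Q = P , cong (P ++_) (≼-antisym Q≼R R≼Q) , A≼P , P≼A′

++-overlap : ∀ (A B C D : List ℕ) → A ++ B ≡ C ++ D →
             (∃ λ W → C ≡ A ++ W × B ≡ W ++ D) ⊎ (∃ λ w → ∃ λ W → A ≡ C ++ w ∷ W × D ≡ w ∷ W ++ B)
++-overlap []      B C       D eq = inj₁ (C , refl , eq)
++-overlap (a ∷ A) B []      D eq = inj₂ (a , A , refl , sym eq)
++-overlap (a ∷ A) B (c ∷ C) D eq with ∷-injective eq
... | refl , eq′ with ++-overlap A B C D eq′
... | inj₁ (W , p , q)     = inj₁ (W , cong (a ∷_) p , q)
... | inj₂ (w , W , p , q) = inj₂ (w , W , cong (a ∷_) p , q)

data TailBounded : List ℕ → Set where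
  []  : TailBounded []
  _∷_ : ∀ {e B} → e ≤ length B → TailBounded B → TailBounded (e ∷ B)

TailBounded-++ : ∀ A {B} → TailBounded A → TailBounded B → TailBounded (A ++ B)
TailBounded-++ []      []       bB = bB
TailBounded-++ (a ∷ A) (h ∷ bA) bB = ℕ.≤-trans h (length-++-≤ˡ A) ∷ TailBounded-++ A bA bB

TailBounded-++⁻ʳ : ∀ A {B} → TailBounded (A ++ B) → TailBounded B
TailBounded-++⁻ʳ []      b       = b
TailBounded-++⁻ʳ (a ∷ A) (_ ∷ b) = TailBounded-++⁻ʳ A b

length-< : ∀ C f (D : List ℕ) → length C < length (C ++ f ∷ D)
length-< C f D = subst (length C <_) (sym (length-++-sucʳ C f D)) (s≤s (length-++-≤ˡ C))

-- A tight entry (one at least the length of its tail) cannot sit strictly inside a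
-- TailBounded prefix of a pointwise larger list, where every entry is below its tail.
tight-position-≤ : ∀ A C {e f B D} → TailBounded C → length B ≤ e →
                   A ++ e ∷ B ≼ C ++ f ∷ D → length C ≤ length A
tight-position-≤ A       []      _        _   _       = z≤n
tight-position-≤ []      (c ∷ C) {f = f} {D = D} (c≤C ∷ _) B≤e (e≤c ∷ p) =
  ⊥-elim (ℕ.<⇒≱ c<B (ℕ.≤-trans B≤e e≤c))
  where
    c<B = ℕ.≤-<-trans c≤C (subst (length C <_) (sym (Pointwise-length p)) (length-< C f D))
tight-position-≤ (a ∷ A) (c ∷ C) (_ ∷ bC) B≤e (_ ∷ p) = s≤s (tight-position-≤ A C bC B≤e p)

tight-sandwich : ∀ {A C c e f R B U} → TailBounded A → TailBounded C →
                 length R ≤ c → length B ≤ e →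
                 C ++ c ∷ R ≼ A ++ e ∷ B → A ++ e ∷ B ≼ C ++ f ∷ U →
                 A ≡ C × R ≼ B × B ≼ U
tight-sandwich {A} {C} {c} {e} {f} {R} {B} {U} bA bC R≤c B≤e lo hi
  with ≼-++⁻ A {e ∷ B} {C} {f ∷ U} |A|≡|C| hi | ≼-++⁻ C {c ∷ R} {A} {e ∷ B} (sym |A|≡|C|) lo
  where
    |A|≡|C| = ℕ.≤-antisym (tight-position-≤ C A bA R≤c lo) (tight-position-≤ A C bC B≤e hi)
... | A≼C , _ ∷ B≼U | C≼A , _ ∷ R≼B = ≼-antisym A≼C C≼A , R≼B , B≼U

tight-split-unique : ∀ {A C e f B D} → TailBounded A → TailBounded C →
                     length B ≤ e → length D ≤ f →
                     A ++ e ∷ B ≡ C ++ f ∷ D → A ≡ C × B ≡ D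
tight-split-unique bA bC B≤e D≤f eq
  with tight-sandwich bA bC D≤f B≤e (≼-reflexive (sym eq)) (≼-reflexive eq)
... | A≡C , D≼B , B≼D = A≡C , ≼-antisym B≼D D≼B

rbv : Tree → List ℕ
rbv ∣       = []
rbv (a ∨ b) = rbv a ++ degree b ∷ rbv b

rbv-shift : Tree → ℕ → List ℕ
rbv-shift ∣       m = []
rbv-shift (a ∨ b) m = rbv a ++ (degree b +ℕ m) ∷ rbv-shift b m

length-node : ∀ (A : List ℕ) e B {m n} → length A ≡ m → length B ≡ n → length (A ++ e ∷ B) ≡ suc (m +ℕ n)
length-node A e B refl refl = trans (length-++ A) (ℕ.+-suc (length A) (length B))

length-rbv : ∀ t → length (rbv t) ≡ degree t
length-rbv ∣       = refl
length-rbv (a ∨ b) = length-node (rbv a) (degree b) (rbv b) (length-rbv a) (length-rbv b)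

length-rbv-shift : ∀ t m → length (rbv-shift t m) ≡ degree t
length-rbv-shift ∣       m = refl
length-rbv-shift (a ∨ b) m =
  length-node (rbv a) (degree b +ℕ m) (rbv-shift b m) (length-rbv a) (length-rbv-shift b m)

length-rbv≤degree : ∀ t → length (rbv t) ≤ degree t
length-rbv≤degree t = ℕ.≤-reflexive (length-rbv t)

rbv-tailBounded : ∀ t → TailBounded (rbv t)
rbv-tailBounded ∣       = []
rbv-tailBounded (a ∨ b) =
  TailBounded-++ (rbv a) (rbv-tailBounded a) (ℕ.≤-reflexive (sym (length-rbv b)) ∷ rbv-tailBounded b)

rbv-∨≢[] : ∀ a b → rbv (a ∨ b) ≡ [] → ⊥
rbv-∨≢[] a b eq with ++-conicalʳ (rbv a) (degree b ∷ rbv b) eq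
... | ()

rbv-injective : ∀ a b → rbv a ≡ rbv b → a ≡ b
rbv-injective ∣         ∣         _  = refl
rbv-injective ∣         (bl ∨ br) eq = ⊥-elim (rbv-∨≢[] bl br (sym eq))
rbv-injective (al ∨ ar) ∣         eq = ⊥-elim (rbv-∨≢[] al ar eq)
rbv-injective (al ∨ ar) (bl ∨ br) eq
  with tight-split-unique (rbv-tailBounded al) (rbv-tailBounded bl)
         (length-rbv≤degree ar) (length-rbv≤degree br) eq
... | l≡ , r≡ = cong₂ _∨_ (rbv-injective al bl l≡) (rbv-injective ar br r≡)

degree-≤T : ∀ {a b} → a ≤T b → degree a ≡ degree b
degree-≤T ≤-refl        = refl
degree-≤T (≤-trans p q) = trans (degree-≤T p) (degree-≤T q)
degree-≤T (≤-assoc {a} {b} {c}) =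
  cong suc (trans (cong (_+ℕ degree c) (sym (ℕ.+-suc (degree a) (degree b))))
                  (ℕ.+-assoc (degree a) (suc (degree b)) (degree c)))
degree-≤T (≤-left {c = c} p)  = cong (λ k → suc (k +ℕ degree c)) (degree-≤T p)
degree-≤T (≤-right {c = c} p) = cong (λ k → suc (degree c +ℕ k)) (degree-≤T p)

rbv-mono : ∀ {a b} → a ≤T b → rbv a ≼ rbv b
rbv-mono ≤-refl        = ≼-refl
rbv-mono (≤-trans p q) = ≼-trans (rbv-mono p) (rbv-mono q)
rbv-mono (≤-assoc {a} {b} {c}) =
  subst (_≼ rbv (a ∨ (b ∨ c))) (sym (++-assoc (rbv a) (degree b ∷ rbv b) (degree c ∷ rbv c)))
    (++⁺ ≼-refl (ℕ.≤-trans (ℕ.m≤m+n (degree b) (degree c)) (ℕ.n≤1+n _) ∷ ≼-refl))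
rbv-mono (≤-left p)  = ≼-++⁺ʳ _ (rbv-mono p)
rbv-mono (≤-right p) = ++⁺ ≼-refl (ℕ.≤-reflexive (degree-≤T p) ∷ rbv-mono p)

degree-\\ : ∀ x y → degree (x \\ y) ≡ degree x +ℕ degree y
degree-\\ ∣       y = refl
degree-\\ (a ∨ b) y =
  cong suc (trans (cong (degree a +ℕ_) (degree-\\ b y)) (sym (ℕ.+-assoc (degree a) (degree b) (degree y))))

rbv-/ : ∀ x y → rbv (x / y) ≡ rbv x ++ rbv y
rbv-/ x ∣       = sym (++-identityʳ (rbv x))
rbv-/ x (l ∨ r) =
  trans (cong (_++ degree r ∷ rbv r) (rbv-/ x l)) (++-assoc (rbv x) (rbv l) (degree r ∷ rbv r))

rbv-\\ : ∀ x y → rbv (x \\ y) ≡ rbv-shift x (degree y) ++ rbv y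
rbv-\\ ∣       y = refl
rbv-\\ (a ∨ b) y =
  trans (cong (rbv a ++_) (cong₂ _∷_ (degree-\\ b y) (rbv-\\ b y)))
        (sym (++-assoc (rbv a) (degree b +ℕ degree y ∷ rbv-shift b (degree y)) (rbv y)))

≼-sandwich-++ʳ⁺ : ∀ {A A′ P R L} → L ≡ P ++ R → A ≼ P → P ≼ A′ → A ++ R ≼ L × L ≼ A′ ++ R
≼-sandwich-++ʳ⁺ refl A≼P P≼A′ = ≼-++⁺ʳ _ A≼P , ≼-++⁺ʳ _ P≼A′

data Shuffle : Tree → Tree → Tree → Set where
  ∣ˡ    : ∀ {y} → Shuffle ∣ y y
  ∣ʳ    : ∀ {x} → Shuffle x ∣ x
  rootˡ : ∀ {xl xr y z} → Shuffle xr y z → Shuffle (xl ∨ xr) y (xl ∨ z)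
  rootʳ : ∀ {x yl yr z} → Shuffle x yl z → Shuffle x (yl ∨ yr) (z ∨ yr)

∣-/ : ∀ y → ∣ / y ≡ y
∣-/ ∣       = refl
∣-/ (l ∨ r) = cong (_∨ r) (∣-/ l)

\\-∣ : ∀ x → x \\ ∣ ≡ x
\\-∣ ∣       = refl
\\-∣ (l ∨ r) = cong (l ∨_) (\\-∣ r)

∨-/-≤T : ∀ a b y → (a ∨ b) / y ≤T a ∨ (b / y)
∨-/-≤T a b ∣       = ≤-refl
∨-/-≤T a b (l ∨ r) = ≤-trans (≤-left (∨-/-≤T a b l)) ≤-assoc

\\-∨-≤T : ∀ x l r → (x \\ l) ∨ r ≤T x \\ (l ∨ r)
\\-∨-≤T ∣       l r = ≤-refl
\\-∨-≤T (a ∨ b) l r = ≤-trans ≤-assoc (≤-right (\\-∨-≤T b l r))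

Shuffle⇒+T : ∀ {x y z} → Shuffle x y z → (x +T y) z
Shuffle⇒+T {y = y} ∣ˡ = subst (_≤T y) (sym (∣-/ y)) ≤-refl , ≤-refl
Shuffle⇒+T {x = x} ∣ʳ = ≤-refl , subst (x ≤T_) (sym (\\-∣ x)) ≤-refl
Shuffle⇒+T (rootˡ {xl} {xr} {y} s) with Shuffle⇒+T s
... | lo , hi = ≤-trans (∨-/-≤T xl xr y) (≤-right lo) , ≤-right hi
Shuffle⇒+T (rootʳ {x} {yl} {yr} s) with Shuffle⇒+T s
... | lo , hi = ≤-left lo , ≤-trans (≤-left hi) (\\-∨-≤T x yl yr)

root-in-y : ∀ {P W} zl zr y → rbv zl ≡ P ++ W → rbv y ≡ W ++ degree zr ∷ rbv zr →
            ∃ λ yl → y ≡ yl ∨ zr × rbv zl ≡ P ++ rbv yl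
root-in-y {W = W} zl zr ∣ _ eq with ++-conicalʳ W _ (sym eq)
... | ()
root-in-y {P} zl zr (yl ∨ yr) zl≡P++W eq
  with tight-split-unique (rbv-tailBounded yl)
         (TailBounded-++⁻ʳ P (subst TailBounded zl≡P++W (rbv-tailBounded zl)))
         (length-rbv≤degree yr) (length-rbv≤degree zr) eq
... | yl≡W , yr≡zr =
  yl , cong (yl ∨_) (rbv-injective yr zr yr≡zr) , trans zl≡P++W (cong (P ++_) (sym yl≡W))

root-in-x : ∀ {m W R} xl xr zl zr → rbv zr ≡ W ++ R →
            rbv (xl ∨ xr) ≼ rbv zl ++ degree zr ∷ W → rbv zl ++ degree zr ∷ W ≼ rbv-shift (xl ∨ xr) m →
            zl ≡ xl × rbv xr ≼ W × W ≼ rbv-shift xr m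
root-in-x {W = W} xl xr zl zr zr≡W++R lo hi =
  map₁ (rbv-injective zl xl)
    (tight-sandwich (rbv-tailBounded zl) (rbv-tailBounded xl) (length-rbv≤degree xr) W≤zr lo hi)
  where
    W≤zr : length W ≤ degree zr
    W≤zr = subst (length W ≤_) (trans (cong length (sym zr≡W++R)) (length-rbv zr)) (length-++-≤ˡ W)

-- The shift m is arbitrary: entries of rbv z are capped by their tails anyway, and
-- this frees the recursion from tracking the degree of y.
Shuffle-complete : ∀ x y z m → rbv x ++ rbv y ≼ rbv z → rbv z ≼ rbv-shift x m ++ rbv y → Shuffle x y z
Shuffle-complete ∣         y z         m lo hi = subst (Shuffle ∣ y) (rbv-injective y z (≼-antisym lo hi)) ∣ˡ
Shuffle-complete (xl ∨ xr) y ∣         m lo hi = ⊥-elim (rbv-∨≢[] xl xr (++-conicalˡ _ (rbv y) (≼[]⇒≡[] lo)))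
Shuffle-complete (xl ∨ xr) y (zl ∨ zr) m lo hi
  with ≼-sandwich-++ʳ (trans (length-rbv (xl ∨ xr)) (sym (length-rbv-shift (xl ∨ xr) m))) lo hi
... | P , z≡P++y , x≼P , P≼x⁺
  with ++-overlap P (rbv y) (rbv zl) (degree zr ∷ rbv zr) (sym z≡P++y)
... | inj₁ (W , zl≡P++W , y≡W++zr) with root-in-y zl zr y zl≡P++W y≡W++zr
... | yl , refl , zl≡P++yl with ≼-sandwich-++ʳ⁺ zl≡P++yl x≼P P≼x⁺
... | lo′ , hi′ = rootʳ (Shuffle-complete (xl ∨ xr) yl zl m lo′ hi′)
Shuffle-complete (xl ∨ xr) y (zl ∨ zr) m lo hi | P , _ , x≼P , P≼x⁺
    | inj₂ (_ , W , P≡zl++W , zr≡W++y) with ∷-injective zr≡W++y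
... | refl , zr≡ with root-in-x xl xr zl zr zr≡ (subst (rbv (xl ∨ xr) ≼_) P≡zl++W x≼P)
                        (subst (_≼ rbv-shift (xl ∨ xr) m) P≡zl++W P≼x⁺)
... | refl , xr≼W , W≼xr⁺ with ≼-sandwich-++ʳ⁺ zr≡ xr≼W W≼xr⁺
... | lo′ , hi′ = rootˡ (Shuffle-complete xr y zr m lo′ hi′)

+T⇒Shuffle : ∀ {x y z} → (x +T y) z → Shuffle x y z
+T⇒Shuffle {x} {y} {z} (lo , hi) =
  Shuffle-complete x y z (degree y)
    (subst (_≼ rbv z) (rbv-/ x y) (rbv-mono lo)) (subst (rbv z ≼_) (rbv-\\ x y) (rbv-mono hi))

Shuffle-assocʳ : ∀ {x y w z t} → Shuffle x y w → Shuffle w z t → ∃ λ u → Shuffle y z u × Shuffle x u t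
Shuffle-assocʳ ∣ˡ        ∣ˡ        = _ , ∣ˡ , ∣ˡ
Shuffle-assocʳ ∣ʳ        ∣ˡ        = _ , ∣ˡ , ∣ˡ
Shuffle-assocʳ s         ∣ʳ        = _ , ∣ʳ , s
Shuffle-assocʳ ∣ˡ        (rootˡ s) = _ , rootˡ s , ∣ˡ
Shuffle-assocʳ ∣ʳ        (rootˡ s) = _ , ∣ˡ , rootˡ s
Shuffle-assocʳ (rootˡ r) (rootˡ s) = map₂ (map₂ rootˡ) (Shuffle-assocʳ r s)
Shuffle-assocʳ (rootʳ r) (rootˡ s) = _ , rootˡ s , rootʳ r
Shuffle-assocʳ r         (rootʳ s) with Shuffle-assocʳ r s
... | _ , s₁ , s₂ = _ , rootʳ s₁ , rootʳ s₂

Shuffle-assocˡ : ∀ {x y u z t} → Shuffle y z u → Shuffle x u t → ∃ λ w → Shuffle x y w × Shuffle w z t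
Shuffle-assocˡ r         ∣ˡ        = _ , ∣ˡ , r
Shuffle-assocˡ ∣ˡ        ∣ʳ        = _ , ∣ʳ , ∣ʳ
Shuffle-assocˡ ∣ʳ        ∣ʳ        = _ , ∣ʳ , ∣ʳ
Shuffle-assocˡ r         (rootˡ s) with Shuffle-assocˡ r s
... | _ , s₁ , s₂ = _ , rootˡ s₁ , rootˡ s₂
Shuffle-assocˡ ∣ˡ        (rootʳ s) = _ , ∣ʳ , rootʳ s
Shuffle-assocˡ ∣ʳ        (rootʳ s) = _ , rootʳ s , ∣ʳ
Shuffle-assocˡ (rootˡ r) (rootʳ s) = _ , rootʳ s , rootˡ r
Shuffle-assocˡ (rootʳ r) (rootʳ s) = map₂ (map₂ rootʳ) (Shuffle-assocˡ r s)

Shuffle-∣ˡ⇒≡ : ∀ {y t} → Shuffle ∣ y t → t ≡ y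
Shuffle-∣ˡ⇒≡ ∣ˡ        = refl
Shuffle-∣ˡ⇒≡ ∣ʳ        = refl
Shuffle-∣ˡ⇒≡ (rootʳ s) = cong (_∨ _) (Shuffle-∣ˡ⇒≡ s)

Shuffle-∣ʳ⇒≡ : ∀ {x t} → Shuffle x ∣ t → t ≡ x
Shuffle-∣ʳ⇒≡ ∣ˡ        = refl
Shuffle-∣ʳ⇒≡ ∣ʳ        = refl
Shuffle-∣ʳ⇒≡ (rootˡ s) = cong (_ ∨_) (Shuffle-∣ʳ⇒≡ s)

IsPosGrove⇒∣∉ : ∀ {G} → IsPosGrove G → ∣ ∉ G
IsPosGrove⇒∣∉ (_ , _ , degree≡) ∣∈G with degree≡ ∣ ∣∈G
... | ()

module _ {x y z : Grove} where

  ⊣-⊣-assoc : ∣ ∉ x → (x ⊣ y) ⊣ z ≐ x ⊣ (y + z)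
  ⊣-⊣-assoc ∣∉x = to , from
    where
      to : (x ⊣ y) ⊣ z ⊆ x ⊣ (y + z)
      to (_ , _ , (∣ , _ , x∋ , _) , _) = ⊥-elim (∣∉x x∋)
      to (_ , c , (xl ∨ xr , b , x∋ , y∋b , g , g∈ , refl) , z∋c , h , h∈ , refl)
        with Shuffle-assocʳ (+T⇒Shuffle g∈) (+T⇒Shuffle h∈)
      ... | u , s₁ , s₂ = xl ∨ xr , u , x∋ , (b , c , y∋b , z∋c , Shuffle⇒+T s₁) , h , Shuffle⇒+T s₂ , refl

      from : x ⊣ (y + z) ⊆ (x ⊣ y) ⊣ z
      from (∣ , _ , x∋ , _) = ⊥-elim (∣∉x x∋)
      from (xl ∨ xr , u , x∋ , (b , c , y∋b , z∋c , u∈) , h , h∈ , refl)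
        with Shuffle-assocˡ (+T⇒Shuffle u∈) (+T⇒Shuffle h∈)
      ... | g , s₁ , s₂ = xl ∨ g , c , (xl ∨ xr , b , x∋ , y∋b , g , Shuffle⇒+T s₁ , refl) , z∋c , h , Shuffle⇒+T s₂ , refl

  ⊢-⊣-assoc : ∣ ∉ y → (x ⊢ y) ⊣ z ≐ x ⊢ (y ⊣ z)
  ⊢-⊣-assoc ∣∉y = to , from
    where
      to : (x ⊢ y) ⊣ z ⊆ x ⊢ (y ⊣ z)
      to (_ , _ , (_ , ∣ , _ , y∋ , _) , _) = ⊥-elim (∣∉y y∋)
      to (_ , c , (a , yl ∨ yr , x∋a , y∋ , g , g∈ , refl) , z∋c , h , h∈ , refl) =
        a , yl ∨ h , x∋a , (yl ∨ yr , c , y∋ , z∋c , h , h∈ , refl) , g , g∈ , refl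

      from : x ⊢ (y ⊣ z) ⊆ (x ⊢ y) ⊣ z
      from (_ , _ , _ , (∣ , _ , y∋ , _) , _) = ⊥-elim (∣∉y y∋)
      from (a , _ , x∋a , (yl ∨ yr , c , y∋ , z∋c , h , h∈ , refl) , g , g∈ , refl) =
        g ∨ yr , c , (a , yl ∨ yr , x∋a , y∋ , g , g∈ , refl) , z∋c , h , h∈ , refl

  +-⊢-assoc : ∣ ∉ z → (x + y) ⊢ z ≐ x ⊢ (y ⊢ z)
  +-⊢-assoc ∣∉z = to , from
    where
      to : (x + y) ⊢ z ⊆ x ⊢ (y ⊢ z)
      to (_ , ∣ , _ , z∋ , _) = ⊥-elim (∣∉z z∋)
      to (w , zl ∨ zr , (a , b , x∋a , y∋b , w∈) , z∋ , g , g∈ , refl)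
        with Shuffle-assocʳ (+T⇒Shuffle w∈) (+T⇒Shuffle g∈)
      ... | h , s₁ , s₂ = a , h ∨ zr , x∋a , (b , zl ∨ zr , y∋b , z∋ , h , Shuffle⇒+T s₁ , refl) , g , Shuffle⇒+T s₂ , refl

      from : x ⊢ (y ⊢ z) ⊆ (x + y) ⊢ z
      from (_ , _ , _ , (_ , ∣ , _ , z∋ , _) , _) = ⊥-elim (∣∉z z∋)
      from (a , _ , x∋a , (b , zl ∨ zr , y∋b , z∋ , h , h∈ , refl) , g , g∈ , refl)
        with Shuffle-assocˡ (+T⇒Shuffle h∈) (+T⇒Shuffle g∈)
      ... | w , s₁ , s₂ = w , zl ∨ zr , (a , b , x∋a , y∋b , Shuffle⇒+T s₁) , z∋ , g , Shuffle⇒+T s₂ , refl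

module _ {x : Grove} (∣∉x : ∣ ∉ x) where

  ∣-⊢-identity : ⟦ ∣ ⟧ ⊢ x ≐ x
  ∣-⊢-identity = to , from
    where
      to : ⟦ ∣ ⟧ ⊢ x ⊆ x
      to (_ , ∣ , _ , x∋ , _) = ⊥-elim (∣∉x x∋)
      to (_ , xl ∨ xr , refl , x∋ , g , g∈ , refl) =
        subst (λ l → x (l ∨ xr)) (sym (Shuffle-∣ˡ⇒≡ (+T⇒Shuffle g∈))) x∋

      from : x ⊆ ⟦ ∣ ⟧ ⊢ x
      from {∣}       x∋ = ⊥-elim (∣∉x x∋)
      from {tl ∨ tr} x∋ = ∣ , tl ∨ tr , refl , x∋ , tl , Shuffle⇒+T ∣ˡ , refl

  ⊣-∣-identity : x ≐ x ⊣ ⟦ ∣ ⟧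
  ⊣-∣-identity = to , from
    where
      to : x ⊆ x ⊣ ⟦ ∣ ⟧
      to {∣}       x∋ = ⊥-elim (∣∉x x∋)
      to {tl ∨ tr} x∋ = tl ∨ tr , ∣ , x∋ , refl , tr , Shuffle⇒+T ∣ʳ , refl

      from : x ⊣ ⟦ ∣ ⟧ ⊆ x
      from (∣ , _ , x∋ , _) = ⊥-elim (∣∉x x∋)
      from (xl ∨ xr , _ , x∋ , refl , h , h∈ , refl) =
        subst (λ r → x (xl ∨ r)) (sym (Shuffle-∣ʳ⇒≡ (+T⇒Shuffle h∈))) x∋

proposition4p4 :
    (∀ (x y z : Grove) → IsPosGrove x → IsPosGrove y → IsPosGrove z →
      ((x ⊣ y) ⊣ z ≐ x ⊣ (y + z))
      × ((x ⊢ y) ⊣ z ≐ x ⊢ (y ⊣ z))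
      × ((x + y) ⊢ z ≐ x ⊢ (y ⊢ z)))
    × (∀ (x : Grove) → IsPosGrove x →
      (⟦ ∣ ⟧ ⊢ x ≐ x) × (x ≐ x ⊣ ⟦ ∣ ⟧))
proposition4p4 =
  (λ x y z px py pz →
     ⊣-⊣-assoc (IsPosGrove⇒∣∉ px) , ⊢-⊣-assoc (IsPosGrove⇒∣∉ py) , +-⊢-assoc (IsPosGrove⇒∣∉ pz)) ,
  (λ x px → ∣-⊢-identity (IsPosGrove⇒∣∉ px) , ⊣-∣-identity (IsPosGrove⇒∣∉ px))
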